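{- Let $k\in\mathbb{N}$ and let $f:2^{[k]}\to\mathbb{N}$ be given by $f(X)=|X|\cdot 2^k+\sum_{x\in X}2^{x-1}$. Then for any $n$ and any family $X_1,\dots,X_n\subseteq[k]$, the family is a partition of $[k]$ (i.e. $X_1\cup\dots\cup X_n=[k]$ and $X_i\cap X_j=\emptyset$ for all $i\neq j$) if and only if $f(X_1)+\dots+f(X_n)=k\cdot 2^k+(2^k-1)$.
   Context: $[k]=\{1,\dots,k\}$. The sets $X_i$ are allowed to be empty. -}

module Defs where

open import Data.Nat using (ℕ; zero; suc; _+_; _*_; _^_)
open import Data.Fin using (Fin; toℕ)
open import Data.Fin.Subset using (Subset; ⊤; _∩_; ⋃; ∣_∣; Empty; _∈_)
open import Data.Vec using (Vec; []; _∷_)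
open import Data.Vec.Functional using ()
open import Data.Bool using (true; false)
open import Data.List using (tabulate)
open import Data.Product using (_×_)
open import Relation.Binary.PropositionalEquality using (_≡_; _≢_)

-- [k] = {1,...,k} is represented by Fin k, with i : Fin k standing for toℕ i + 1.
-- A subset X ⊆ [k] is a Subset k (a Vec of inside/outside flags).

sumOver : ∀ {k} → Subset k → (Fin k → ℕ) → ℕ
sumOver [] g = 0
sumOver {suc k} (true ∷ X) g = g Data.Fin.zero + sumOver X (λ i → g (Data.Fin.suc i))
sumOver {suc k} (false ∷ X) g = sumOver X (λ i → g (Data.Fin.suc i))

-- f(X) = |X| * 2^k + Σ_{x ∈ X} 2^(x-1); element x = toℕ i + 1, so 2^(x-1) = 2^(toℕ i)
f : (k : ℕ) → Subset k → ℕ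
f k X = ∣ X ∣ * 2 ^ k + sumOver X (λ i → 2 ^ toℕ i)

sumFin : (n : ℕ) → (Fin n → ℕ) → ℕ
sumFin zero a = 0
sumFin (suc n) a = a Data.Fin.zero + sumFin n (λ i → a (Data.Fin.suc i))

IsPartition : (k n : ℕ) → (Fin n → Subset k) → Set
IsPartition k n X = (⋃ (tabulate X) ≡ ⊤) × (∀ i j → i ≢ j → Empty (X i ∩ X j))

{-# OPTIONS --safe #-}
-- Let c x be the number of blocks X i containing x. Double counting gives
-- Σ f(X i) = (Σ c) 2^k + Σ c x 2^x, and the family is a partition exactly when c ≡ 1,
-- which yields k 2^k + (2^k - 1). Conversely, that value forces Σ c ≤ k and
-- 2^k ∣ 1 + Σ c x 2^x. Reading the latter digit by digit from the bottom, each digit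
-- plus its incoming carry is odd, and a carry e consumes 2e units of digit sum while
-- supplying only e to the next digit; so with only k units available every carry is 0
-- and every digit is 1.
module Submission where

open import Defs
open import Data.Nat.Properties
open import Algebra.Properties.CommutativeMonoid.Sum +-0-commutativeMonoid
  using (sum; sum-cong-≗; ∑-distrib-+; ∑-comm; sum-syntax)
open import Algebra.Properties.Semiring.Sum +-*-semiring
  using (*-distribˡ-sum; *-distribʳ-sum)
open import Algebra.Properties.CommutativeSemigroup *-commutativeSemigroup
  using (x∙yz≈y∙xz)
open import Data.Bool using (Bool; true; false)
open import Data.Empty using (⊥; ⊥-elim)
open import Data.Fin using (Fin; zero; suc; toℕ)
import Data.Fin.Properties as Finₚ
open import Data.Fin.Subset using (Subset; _∩_; ⋃; ∣_∣; Empty; _∈_)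
open import Data.Fin.Subset.Properties
  using (_∈?_; ∈⊤; ∉⊥; ⊆-antisym; x∈p∪q⁺; x∈p∪q⁻; x∈p∩q⁺; x∈p∩q⁻)
open import Data.List using (tabulate)
open import Data.Nat using (ℕ; zero; suc; _+_; _*_; _∸_; _^_; _≤_; _<_; s≤s⁻¹; _≤?_)
open import Data.Nat.Divisibility using (_∣_; divides)
open import Data.Nat.Tactic.RingSolver using (solve-∀)
open import Data.Product using (_×_; _,_; ∃; proj₁; proj₂)
open import Data.Sum using (inj₁; inj₂)
open import Data.Vec using ([]; _∷_)
open import Data.Vec.Functional using (tail)
open import Function using (_∘_; _⇔_; mk⇔; Equivalence)
open import Relation.Nullary using (¬_; yes; no; does)
open import Relation.Unary using (Decidable)
open import Relation.Binary.PropositionalEquality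
  using (_≡_; _≢_; refl; sym; trans; cong; cong₂; subst; module ≡-Reasoning)

𝟙 : Bool → ℕ
𝟙 true = 1
𝟙 false = 0

count : ∀ {n} {P : Fin n → Set} → Decidable P → ℕ
count {n} P? = ∑[ i < n ] 𝟙 (does (P? i))

count≡0⇒∄ : ∀ {n} {P : Fin n → Set} (P? : Decidable P) → count P? ≡ 0 → ∀ i → ¬ P i
count≡0⇒∄ {suc n} P? eq i with P? zero
count≡0⇒∄ P? () i | yes _
count≡0⇒∄ P? eq zero | no ¬p₀ = ¬p₀
count≡0⇒∄ P? eq (suc i) | no _ = count≡0⇒∄ (P? ∘ suc) eq i

∄⇒count≡0 : ∀ {n} {P : Fin n → Set} (P? : Decidable P) → (∀ i → ¬ P i) → count P? ≡ 0
∄⇒count≡0 {zero} P? ∄ = refl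
∄⇒count≡0 {suc n} P? ∄ with P? zero
... | yes p = ⊥-elim (∄ zero p)
... | no _ = ∄⇒count≡0 (P? ∘ suc) (∄ ∘ suc)

ExactlyOne : ∀ {n} → (Fin n → Set) → Set
ExactlyOne P = ∃ P × (∀ i j → i ≢ j → P i → P j → ⊥)

count≡1⇒ExactlyOne : ∀ {n} {P : Fin n → Set} (P? : Decidable P) → count P? ≡ 1 → ExactlyOne P
count≡1⇒ExactlyOne {suc n} {P} P? eq with P? zero
... | yes p₀ = (zero , p₀) , unique
  where
  ∄ : ∀ i → ¬ P (suc i)
  ∄ = count≡0⇒∄ (P? ∘ suc) (suc-injective eq)
  unique : ∀ i j → i ≢ j → P i → P j → ⊥
  unique zero zero i≢j _ _ = i≢j refl
  unique zero (suc j) _ _ pj = ∄ j pj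
  unique (suc i) _ _ pi _ = ∄ i pi
... | no ¬p₀ = (suc (proj₁ witness) , proj₂ witness) , unique
  where
  ih : ExactlyOne (P ∘ suc)
  ih = count≡1⇒ExactlyOne (P? ∘ suc) eq
  witness = proj₁ ih
  unique : ∀ i j → i ≢ j → P i → P j → ⊥
  unique zero _ _ p₀ _ = ¬p₀ p₀
  unique (suc i) zero _ _ p₀ = ¬p₀ p₀
  unique (suc i) (suc j) i≢j = proj₂ ih i j (i≢j ∘ cong suc)

ExactlyOne⇒count≡1 : ∀ {n} {P : Fin n → Set} (P? : Decidable P) → ExactlyOne P → count P? ≡ 1
ExactlyOne⇒count≡1 {suc n} {P} P? ((i , pi) , unique) with P? zero
... | yes p₀ = cong suc (∄⇒count≡0 (P? ∘ suc) (λ j → unique zero (suc j) (λ ()) p₀))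
... | no ¬p₀ = ExactlyOne⇒count≡1 (P? ∘ suc) (witness i pi , λ i j i≢j → unique (suc i) (suc j) (i≢j ∘ Finₚ.suc-injective))
  where
  witness : ∀ i → P i → ∃ (P ∘ suc)
  witness zero p₀ = ⊥-elim (¬p₀ p₀)
  witness (suc i) pi = i , pi

x∈⋃⁻ : ∀ {n k} (X : Fin n → Subset k) {x} → x ∈ ⋃ (tabulate X) → ∃ λ i → x ∈ X i
x∈⋃⁻ {zero} X x∈⊥ = ⊥-elim (∉⊥ x∈⊥)
x∈⋃⁻ {suc n} X x∈⋃ with x∈p∪q⁻ (X zero) (⋃ (tabulate (X ∘ suc))) x∈⋃
... | inj₁ x∈X₀ = zero , x∈X₀
... | inj₂ x∈⋃′ with x∈⋃⁻ (X ∘ suc) x∈⋃′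
...   | i , x∈Xᵢ = suc i , x∈Xᵢ

x∈⋃⁺ : ∀ {n k} (X : Fin n → Subset k) {x} i → x ∈ X i → x ∈ ⋃ (tabulate X)
x∈⋃⁺ X zero x∈X₀ = x∈p∪q⁺ (inj₁ x∈X₀)
x∈⋃⁺ X (suc i) x∈Xᵢ = x∈p∪q⁺ (inj₂ (x∈⋃⁺ (X ∘ suc) i x∈Xᵢ))

IsPartition⇔ExactlyOne : ∀ k n (X : Fin n → Subset k) →
  IsPartition k n X ⇔ (∀ x → ExactlyOne (λ i → x ∈ X i))
IsPartition⇔ExactlyOne k n X = mk⇔ to from
  where
  to : IsPartition k n X → ∀ x → ExactlyOne (λ i → x ∈ X i)
  to (covers , disjoint) x =
    x∈⋃⁻ X (subst (x ∈_) (sym covers) ∈⊤) ,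
    λ i j i≢j x∈Xᵢ x∈Xⱼ → disjoint i j i≢j (x , x∈p∩q⁺ (x∈Xᵢ , x∈Xⱼ))
  from : (∀ x → ExactlyOne (λ i → x ∈ X i)) → IsPartition k n X
  from one = ⊆-antisym (λ _ → ∈⊤) (λ {x} _ → x∈⋃⁺ X _ (proj₂ (proj₁ (one x)))) , disjoint
    where
    disjoint : ∀ i j → i ≢ j → Empty (X i ∩ X j)
    disjoint i j i≢j (x , x∈Xᵢ∩Xⱼ) =
      let (x∈Xᵢ , x∈Xⱼ) = x∈p∩q⁻ (X i) (X j) x∈Xᵢ∩Xⱼ in proj₂ (one x) i j i≢j x∈Xᵢ x∈Xⱼ

multiplicity : ∀ {k n} → (Fin n → Subset k) → Fin k → ℕ
multiplicity X x = count (λ i → x ∈? X i)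

IsPartition⇔multiplicity≡1 : ∀ k n (X : Fin n → Subset k) →
  IsPartition k n X ⇔ (∀ x → multiplicity X x ≡ 1)
IsPartition⇔multiplicity≡1 k n X = mk⇔
  (λ P x → ExactlyOne⇒count≡1 (λ i → x ∈? X i) (Equivalence.to (IsPartition⇔ExactlyOne k n X) P x))
  (λ m≡1 → Equivalence.from (IsPartition⇔ExactlyOne k n X) (λ x → count≡1⇒ExactlyOne (λ i → x ∈? X i) (m≡1 x)))

sumFin≡sum : ∀ n (a : Fin n → ℕ) → sumFin n a ≡ sum a
sumFin≡sum zero a = refl
sumFin≡sum (suc n) a = cong (a zero +_) (sumFin≡sum n (a ∘ suc))

sumOver≡∑ : ∀ {k} (p : Subset k) (g : Fin k → ℕ) → sumOver p g ≡ ∑[ x < k ] (𝟙 (does (x ∈? p)) * g x)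
sumOver≡∑ [] g = refl
sumOver≡∑ (true ∷ p) g = cong₂ _+_ (sym (+-identityʳ (g zero))) (sumOver≡∑ p (g ∘ suc))
sumOver≡∑ (false ∷ p) g = sumOver≡∑ p (g ∘ suc)

∣p∣≡sumOver-1 : ∀ {k} (p : Subset k) → ∣ p ∣ ≡ sumOver p (λ _ → 1)
∣p∣≡sumOver-1 [] = refl
∣p∣≡sumOver-1 (true ∷ p) = cong suc (∣p∣≡sumOver-1 p)
∣p∣≡sumOver-1 (false ∷ p) = ∣p∣≡sumOver-1 p

∑-sumOver : ∀ {k n} (X : Fin n → Subset k) (g : Fin k → ℕ) →
  ∑[ i < n ] sumOver (X i) g ≡ ∑[ x < k ] (multiplicity X x * g x)
∑-sumOver {k} {n} X g = begin
  ∑[ i < n ] sumOver (X i) g                          ≡⟨ sum-cong-≗ (λ i → sumOver≡∑ (X i) g) ⟩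
  ∑[ i < n ] ∑[ x < k ] (𝟙 (does (x ∈? X i)) * g x)     ≡⟨ ∑-comm (λ i x → 𝟙 (does (x ∈? X i)) * g x) ⟩
  ∑[ x < k ] ∑[ i < n ] (𝟙 (does (x ∈? X i)) * g x)     ≡⟨ sum-cong-≗ (λ x → sym (*-distribʳ-sum (g x) (λ i → 𝟙 (does (x ∈? X i))))) ⟩
  ∑[ x < k ] (multiplicity X x * g x)                   ∎
  where open ≡-Reasoning

∑-∣∣ : ∀ {k n} (X : Fin n → Subset k) → ∑[ i < n ] ∣ X i ∣ ≡ sum (multiplicity X)
∑-∣∣ X = begin
  sum (λ i → ∣ X i ∣)                         ≡⟨ sum-cong-≗ (λ i → ∣p∣≡sumOver-1 (X i)) ⟩
  sum (λ i → sumOver (X i) (λ _ → 1))        ≡⟨ ∑-sumOver X (λ _ → 1) ⟩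
  sum (λ x → multiplicity X x * 1)            ≡⟨ sum-cong-≗ (λ x → *-identityʳ (multiplicity X x)) ⟩
  sum (multiplicity X)                        ∎
  where open ≡-Reasoning

binary : ∀ {k} → (Fin k → ℕ) → ℕ
binary {k} c = ∑[ x < k ] (c x * 2 ^ toℕ x)

∑-f≡ : ∀ k n (X : Fin n → Subset k) →
  sumFin n (λ i → f k (X i)) ≡ sum (multiplicity X) * 2 ^ k + binary (multiplicity X)
∑-f≡ k n X = begin
  sumFin n (λ i → f k (X i))
    ≡⟨ sumFin≡sum n _ ⟩
  ∑[ i < n ] (∣ X i ∣ * 2 ^ k + sumOver (X i) pow)
    ≡⟨ ∑-distrib-+ (λ i → ∣ X i ∣ * 2 ^ k) (λ i → sumOver (X i) pow) ⟩
  ∑[ i < n ] (∣ X i ∣ * 2 ^ k) + ∑[ i < n ] sumOver (X i) pow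
    ≡⟨ cong₂ _+_ (sym (*-distribʳ-sum (2 ^ k) (λ i → ∣ X i ∣))) (∑-sumOver X pow) ⟩
  ∑[ i < n ] ∣ X i ∣ * 2 ^ k + binary (multiplicity X)
    ≡⟨ cong (λ s → s * 2 ^ k + binary (multiplicity X)) (∑-∣∣ X) ⟩
  sum (multiplicity X) * 2 ^ k + binary (multiplicity X)
    ∎
  where
  open ≡-Reasoning
  pow : Fin k → ℕ
  pow x = 2 ^ toℕ x

binary-suc : ∀ {k} (c : Fin (suc k) → ℕ) → binary c ≡ c zero + 2 * binary (tail c)
binary-suc {k} c = cong₂ _+_ (*-identityʳ (c zero)) (begin
  ∑[ x < k ] (c (suc x) * (2 * 2 ^ toℕ x))   ≡⟨ sum-cong-≗ (λ x → x∙yz≈y∙xz (c (suc x)) 2 (2 ^ toℕ x)) ⟩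
  ∑[ x < k ] (2 * (c (suc x) * 2 ^ toℕ x))   ≡⟨ sym (*-distribˡ-sum 2 (λ x → c (suc x) * 2 ^ toℕ x)) ⟩
  2 * binary (tail c)                        ∎)
  where open ≡-Reasoning

sum-ones : ∀ {k} (c : Fin k → ℕ) → (∀ x → c x ≡ 1) → sum c ≡ k
sum-ones {zero} c ones = refl
sum-ones {suc k} c ones = cong₂ _+_ (ones zero) (sum-ones (tail c) (ones ∘ suc))

binary-ones : ∀ {k} (c : Fin k → ℕ) → (∀ x → c x ≡ 1) → suc (binary c) ≡ 2 ^ k
binary-ones {zero} c ones = refl
binary-ones {suc k} c ones = begin
  suc (binary c)                     ≡⟨ cong suc (binary-suc c) ⟩
  suc (c zero + 2 * binary (tail c))  ≡⟨ cong (λ a → suc (a + 2 * binary (tail c))) (ones zero) ⟩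
  suc (suc (2 * binary (tail c)))     ≡⟨ sym (*-suc 2 (binary (tail c))) ⟩
  2 * suc (binary (tail c))           ≡⟨ cong (2 *_) (binary-ones (tail c) (ones ∘ suc)) ⟩
  2 * 2 ^ k                           ∎
  where open ≡-Reasoning

halve : ∀ a b z → suc (a + 2 * b) ≡ 2 * z → ∃ λ e → a ≡ suc (2 * e) × suc (e + b) ≡ z
halve zero b z eq = ⊥-elim (even≢odd z b (sym eq))
halve (suc zero) b z eq = 0 , refl , *-cancelˡ-≡ (suc b) z 2 (trans (*-suc 2 b) eq)
halve (suc (suc a)) b z eq =
  let (e , a≡ , eq′) = halve a (suc b) z (trans (cong suc carry) eq)
  in suc e , cong suc (trans (cong suc a≡) (sym (*-suc 2 e))) , trans (cong suc (sym (+-suc e b))) eq′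
  where
  carry : a + 2 * suc b ≡ suc (suc (a + 2 * b))
  carry = trans (cong (a +_) (*-suc 2 b)) (trans (+-suc a _) (cong suc (+-suc a _)))

divides-halve : ∀ {k} a b → 2 ^ suc k ∣ suc (a + 2 * b) → ∃ λ e → a ≡ suc (2 * e) × 2 ^ k ∣ suc (e + b)
divides-halve {k} a b (divides q eq) =
  let (e , a≡ , eq′) = halve a b (q * 2 ^ k) (trans eq (x∙yz≈y∙xz q 2 (2 ^ k)))
  in e , a≡ , divides q eq′

carry-step : ∀ {k} d (c : Fin (suc k) → ℕ) → 2 ^ suc k ∣ suc (d + binary c) → d + sum c ≤ suc k →
  ∃ λ e → d + c zero ≡ suc (2 * e) × 2 ^ k ∣ suc (e + binary (tail c)) × 2 * e + sum (tail c) ≤ k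
carry-step {k} d c 2^∣ bound =
  let (e , d+c₀≡ , 2^k∣) = divides-halve {k} (d + c zero) (binary (tail c)) (subst (2 ^ suc k ∣_) (cong suc split) 2^∣)
  in e , d+c₀≡ , 2^k∣ ,
     s≤s⁻¹ (subst (_≤ suc k) (trans (sym (+-assoc d (c zero) _)) (cong (_+ sum (tail c)) d+c₀≡)) bound)
  where
  split : d + binary c ≡ d + c zero + 2 * binary (tail c)
  split = trans (cong (d +_) (binary-suc c)) (sym (+-assoc d (c zero) _))

carry-in : ∀ k d (c : Fin (suc k) → ℕ) → 2 ^ suc k ∣ suc (d + binary c) → d + sum c ≤ suc k →
  d + c zero ≡ 1 × (∀ x → c (suc x) ≡ 1)

carry-vanishes : ∀ k e (c : Fin (suc k) → ℕ) → 2 ^ k ∣ suc (e + binary (tail c)) → 2 * e + sum (tail c) ≤ k →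
  e ≡ 0 × (∀ x → c (suc x) ≡ 1)

carry-in k d c 2^∣ bound =
  let (e , d+c₀≡ , 2^k∣ , bound′) = carry-step d c 2^∣ bound
      (e≡0 , ones) = carry-vanishes k e c 2^k∣ bound′
  in trans d+c₀≡ (cong (λ t → suc (2 * t)) e≡0) , ones

carry-vanishes zero e c _ bound′ = n≤0⇒n≡0 (≤-trans (≤-trans (m≤n*m e 2) (m≤m+n (2 * e) _)) bound′) , λ ()
carry-vanishes (suc k) e c 2^k∣ bound′ =
  e≡0 , λ { zero → trans (cong (_+ c₁) (sym e≡0)) e+c₁≡1 ; (suc x) → ones x }
  where
  open ≡-Reasoning
  c₁ = c (suc zero)
  next = carry-in k e (tail c) 2^k∣ (≤-trans (+-monoˡ-≤ (sum (tail c)) (m≤n*m e 2)) bound′)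
  e+c₁≡1 = proj₁ next
  ones = proj₂ next
  regroup : ∀ e a k → e + (e + a + k) ≡ 2 * e + (a + k)
  regroup e a k = trans (cong (e +_) (+-assoc e a k))
    (trans (sym (+-assoc e e (a + k))) (cong (λ t → e + t + (a + k)) (sym (+-identityʳ e))))
  e+suc-k : e + suc k ≡ 2 * e + sum (tail c)
  e+suc-k = begin
    e + suc k                ≡⟨ cong (λ t → e + (t + k)) (sym e+c₁≡1) ⟩
    e + (e + c₁ + k)          ≡⟨ regroup e c₁ k ⟩
    2 * e + (c₁ + k)          ≡⟨ cong (λ t → 2 * e + (c₁ + t)) (sym (sum-ones (tail (tail c)) ones)) ⟩
    2 * e + sum (tail c)      ∎
  e≡0 : e ≡ 0
  e≡0 = n≤0⇒n≡0 (+-cancelʳ-≤ (suc k) e 0 (subst (_≤ suc k) (sym e+suc-k) bound′))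

∣suc-binary⇒ones : ∀ k (c : Fin k → ℕ) → 2 ^ k ∣ suc (binary c) → sum c ≤ k → ∀ x → c x ≡ 1
∣suc-binary⇒ones (suc k) c 2^∣ bound zero = proj₁ (carry-in k 0 c 2^∣ bound)
∣suc-binary⇒ones (suc k) c 2^∣ bound (suc x) = proj₂ (carry-in k 0 c 2^∣ bound) x

m*N+v≡k*N+[N∸1]⇒m≤k×N∣1+v : ∀ {N m k v} → 0 < N → m * N + v ≡ k * N + (N ∸ 1) → m ≤ k × N ∣ suc v
m*N+v≡k*N+[N∸1]⇒m≤k×N∣1+v {suc p} {m} {k} {v} _ eq with m ≤? k
... | yes m≤k with m≤n⇒∃[o]m+o≡n m≤k
...   | t , refl = m≤k , divides (suc t) (+-cancelˡ-≡ (m * suc p) (suc v) (suc t * suc p) (begin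
  m * suc p + suc v             ≡⟨ +-suc (m * suc p) v ⟩
  suc (m * suc p + v)           ≡⟨ cong suc eq ⟩
  suc ((m + t) * suc p + p)     ≡⟨ regroup m t p ⟩
  m * suc p + suc t * suc p     ∎))
  where
  open ≡-Reasoning
  regroup : ∀ m t p → suc ((m + t) * suc p + p) ≡ m * suc p + suc t * suc p
  regroup = solve-∀
m*N+v≡k*N+[N∸1]⇒m≤k×N∣1+v {suc p} {m} {k} {v} _ eq | no m≰k = ⊥-elim (<-irrefl refl (begin-strict
  k * suc p + p      ≡⟨ +-comm (k * suc p) p ⟩
  p + k * suc p      <⟨ n<1+n _ ⟩
  suc k * suc p      ≤⟨ *-monoˡ-≤ (suc p) (≰⇒> m≰k) ⟩
  m * suc p          ≤⟨ m≤m+n (m * suc p) v ⟩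
  m * suc p + v      ≡⟨ eq ⟩
  k * suc p + p      ∎))
  where open ≤-Reasoning

lemma9 : (k n : ℕ) → (X : Fin n → Subset k) →
    (IsPartition k n X → sumFin n (λ i → f k (X i)) ≡ k * 2 ^ k + (2 ^ k ∸ 1))
    × (sumFin n (λ i → f k (X i)) ≡ k * 2 ^ k + (2 ^ k ∸ 1) → IsPartition k n X)
lemma9 k n X = partition⇒sum , sum⇒partition
  where
  open ≡-Reasoning
  c = multiplicity X
  partition⇒sum : IsPartition k n X → sumFin n (λ i → f k (X i)) ≡ k * 2 ^ k + (2 ^ k ∸ 1)
  partition⇒sum P = begin
    sumFin n (λ i → f k (X i))    ≡⟨ ∑-f≡ k n X ⟩
    sum c * 2 ^ k + binary c      ≡⟨ cong₂ (λ s b → s * 2 ^ k + b) (sum-ones c ones) (cong (_∸ 1) (binary-ones c ones)) ⟩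
    k * 2 ^ k + (2 ^ k ∸ 1)       ∎
    where ones = Equivalence.to (IsPartition⇔multiplicity≡1 k n X) P
  sum⇒partition : sumFin n (λ i → f k (X i)) ≡ k * 2 ^ k + (2 ^ k ∸ 1) → IsPartition k n X
  sum⇒partition eq =
    let (sum≤k , 2^k∣) = m*N+v≡k*N+[N∸1]⇒m≤k×N∣1+v (m^n>0 2 k) (trans (sym (∑-f≡ k n X)) eq)
    in Equivalence.from (IsPartition⇔multiplicity≡1 k n X) (∣suc-binary⇒ones k c 2^k∣ sum≤k)
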